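{- Let $u^{(1)},\dots,u^{(k)}$ ($k\ge1$) be integer intervals in $[1,n]$, let $I_{maxl}=\max_i u^{(i)}_l$, $I_{minr}=\min_i u^{(i)}_r$, and let $\rho=\bigcap_{i=1}^k v_{u^{(i)}}$. Let $u=[u_l,u_r]\subseteq[1,n]$ be an interval with $I_{maxl}\le u_l$. If $v_u\cap\rho\neq\emptyset$, then $v_u\cap\rho=v_{[u_l,\min(I_{minr},u_r)]}$.
   Context: Board: $n\times n$, files and ranks numbered $1,\dots,n$. A pawn-square is a square $s$ at file $f$, rank $r$ with $2\le r\le n-1$; its set of potential starting files is $\mu_s=\{g\in\mathbb{Z}:\max(1,f-(r-2))\le g\le\min(n,f+(r-2))\}$. For an integer interval $u\subseteq[1,n]$, $v_u$ is the set of pawn-squares $s$ with $\mu_s\subseteq u$. Intervals are processed in lexicographic order of (left endpoint, right endpoint), and $u$ is processed after $u^{(1)},\dots,u^{(k)}$. -}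

module Defs where

open import Data.Nat using (ℕ; zero; suc; _≤_; _∸_; _+_; _⊔_; _⊓_)
open import Data.Fin using (Fin; zero; suc)
open import Data.Product using (_×_; _,_; proj₁; proj₂)
open import Function using (_∘_)

Interval : Set
Interval = ℕ × ℕ

IntervalIn : ℕ → Interval → Set
IntervalIn n (l , r) = 1 ≤ l × l ≤ r × r ≤ n

_∈I_ : ℕ → Interval → Set
g ∈I (l , r) = l ≤ g × g ≤ r

-- A square is (file , rank).
Square : Set
Square = ℕ × ℕ

PawnSquare : ℕ → Square → Set
PawnSquare n (f , r) = 1 ≤ f × f ≤ n × 2 ≤ r × r ≤ n ∸ 1

-- μ_s = { g : max(1, f-(r-2)) ≤ g ≤ min(n, f+(r-2)) }.
-- (All elements are ≥ 1, so ℕ suffices; truncated subtraction followed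
-- by max with 1 agrees with the integer max(1, f-(r-2)).)
μ : ℕ → Square → ℕ → Set
μ n (f , r) g = (1 ⊔ (f ∸ (r ∸ 2))) ≤ g × g ≤ (n ⊓ (f + (r ∸ 2)))

_∈v[_]_ : Square → ℕ → Interval → Set
s ∈v[ n ] u = PawnSquare n s × (∀ g → μ n s g → g ∈I u)

maxL : ∀ {k} → (Fin (suc k) → Interval) → ℕ
maxL {zero}  us = proj₁ (us zero)
maxL {suc k} us = proj₁ (us zero) ⊔ maxL (us ∘ suc)

minR : ∀ {k} → (Fin (suc k) → Interval) → ℕ
minR {zero}  us = proj₂ (us zero)
minR {suc k} us = proj₂ (us zero) ⊓ minR (us ∘ suc)

_∈ρ[_]_ : ∀ {k} → Square → ℕ → (Fin (suc k) → Interval) → Set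
s ∈ρ[ n ] us = ∀ i → s ∈v[ n ] us i

{-# OPTIONS --safe #-}
module Submission where

open import Defs
open import Data.Nat using (ℕ; zero; suc; _≤_; _⊓_; _⊔_)
open import Data.Nat.Properties
  using (≤-refl; ≤-trans; m≤m⊔n; m≤n⊔m; m⊓n≤m; m⊓n≤n; ⊓-glb; ⊔-lub; m≤n⇒m⊔n≡n)
open import Data.Fin using (Fin; zero; suc)
open import Data.Product using (_×_; _,_; proj₁; proj₂; ∃; swap)
open import Data.Product.Function.NonDependent.Propositional using (_×-⇔_)
open import Function using (_∘_)
open import Function.Bundles using (_⇔_; mk⇔; Equivalence)
open import Function.Properties.Equivalence using (refl; trans)
open import Relation.Binary.PropositionalEquality using (subst)

-- ρ is itself a v-set, namely that of the intersection [maxL, minR] of the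
-- u⁽ⁱ⁾, and v turns intersections of intervals into intersections of sets.
-- Since maxL ≤ u_l, the intersection of [maxL, minR] with u is
-- [u_l, minR ⊓ u_r].

_∩I_ : Interval → Interval → Interval
(l , r) ∩I (l′ , r′) = (l ⊔ l′ , r ⊓ r′)

⋂I : ∀ {k} → (Fin (suc k) → Interval) → Interval
⋂I us = (maxL us , minR us)

maxL-upper : ∀ {k} (us : Fin (suc k) → Interval) i → proj₁ (us i) ≤ maxL us
maxL-upper {zero}  us zero    = ≤-refl
maxL-upper {suc k} us zero    = m≤m⊔n _ _
maxL-upper {suc k} us (suc i) = ≤-trans (maxL-upper (us ∘ suc) i) (m≤n⊔m _ _)

maxL-least : ∀ {k} (us : Fin (suc k) → Interval) {x} → (∀ i → proj₁ (us i) ≤ x) → maxL us ≤ x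
maxL-least {zero}  us h = h zero
maxL-least {suc k} us h = ⊔-lub (h zero) (maxL-least (us ∘ suc) (h ∘ suc))

minR-lower : ∀ {k} (us : Fin (suc k) → Interval) i → minR us ≤ proj₂ (us i)
minR-lower {zero}  us zero    = ≤-refl
minR-lower {suc k} us zero    = m⊓n≤m _ _
minR-lower {suc k} us (suc i) = ≤-trans (m⊓n≤n _ _) (minR-lower (us ∘ suc) i)

minR-greatest : ∀ {k} (us : Fin (suc k) → Interval) {x} → (∀ i → x ≤ proj₂ (us i)) → x ≤ minR us
minR-greatest {zero}  us h = h zero
minR-greatest {suc k} us h = ⊓-glb (h zero) (minR-greatest (us ∘ suc) (h ∘ suc))

∈I×∈I⇔∈I∩I : ∀ {g} u w → (g ∈I u × g ∈I w) ⇔ g ∈I (u ∩I w)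
∈I×∈I⇔∈I∩I (l , r) (l′ , r′) = mk⇔
  (λ ((l≤g , g≤r) , (l′≤g , g≤r′)) → ⊔-lub l≤g l′≤g , ⊓-glb g≤r g≤r′)
  (λ (l⊔l′≤g , g≤r⊓r′) →
     (≤-trans (m≤m⊔n l l′) l⊔l′≤g , ≤-trans g≤r⊓r′ (m⊓n≤m r r′)) ,
     (≤-trans (m≤n⊔m l l′) l⊔l′≤g , ≤-trans g≤r⊓r′ (m⊓n≤n r r′)))

∀∈I⇔∈I⋂I : ∀ {k g} (us : Fin (suc k) → Interval) → (∀ i → g ∈I us i) ⇔ g ∈I ⋂I us
∀∈I⇔∈I⋂I us = mk⇔
  (λ h → maxL-least us (proj₁ ∘ h) , minR-greatest us (proj₂ ∘ h))
  (λ (maxL≤g , g≤minR) i →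
     ≤-trans (maxL-upper us i) maxL≤g , ≤-trans g≤minR (minR-lower us i))

∈v×∈v⇔∈v∩I : ∀ {n s} u w → (s ∈v[ n ] u × s ∈v[ n ] w) ⇔ s ∈v[ n ] (u ∩I w)
∈v×∈v⇔∈v∩I u w = mk⇔
  (λ ((ps , μ⊆u) , (_ , μ⊆w)) → ps , λ g m → Equivalence.to (∈I×∈I⇔∈I∩I u w) (μ⊆u g m , μ⊆w g m))
  (λ (ps , μ⊆u∩w) →
     (ps , λ g m → proj₁ (Equivalence.from (∈I×∈I⇔∈I∩I u w) (μ⊆u∩w g m))) ,
     (ps , λ g m → proj₂ (Equivalence.from (∈I×∈I⇔∈I∩I u w) (μ⊆u∩w g m))))

∈ρ⇔∈v⋂I : ∀ {n k s} (us : Fin (suc k) → Interval) → s ∈ρ[ n ] us ⇔ s ∈v[ n ] ⋂I us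
∈ρ⇔∈v⋂I us = mk⇔
  (λ h → proj₁ (h zero) , λ g m → Equivalence.to (∀∈I⇔∈I⋂I us) (λ i → proj₂ (h i) g m))
  (λ (ps , μ⊆⋂) i → ps , λ g m → Equivalence.from (∀∈I⇔∈I⋂I us) (μ⊆⋂ g m) i)

∈v×∈ρ⇔∈v∩I : ∀ {n k s} (us : Fin (suc k) → Interval) u →
                (s ∈v[ n ] u × s ∈ρ[ n ] us) ⇔ s ∈v[ n ] (⋂I us ∩I u)
∈v×∈ρ⇔∈v∩I us u =
  trans (mk⇔ swap swap) (trans (∈ρ⇔∈v⋂I us ×-⇔ refl) (∈v×∈v⇔∈v∩I (⋂I us) u))

lemma4 : (n k : ℕ) (us : Fin (suc k) → Interval) (u : Interval)
    → (∀ i → IntervalIn n (us i)) → IntervalIn n u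
    → maxL us ≤ proj₁ u
    → ∃ (λ s → s ∈v[ n ] u × s ∈ρ[ n ] us)
    → ∀ s → (s ∈v[ n ] u × s ∈ρ[ n ] us) ⇔ (s ∈v[ n ] (proj₁ u , minR us ⊓ proj₂ u))
lemma4 n k us u@(ul , ur) _ _ maxL≤ul _ s =
  subst (λ l → (s ∈v[ n ] u × s ∈ρ[ n ] us) ⇔ s ∈v[ n ] (l , minR us ⊓ ur))
        (m≤n⇒m⊔n≡n maxL≤ul)
        (∈v×∈ρ⇔∈v∩I us u)
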